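{- Let $G$ be a finite group of even order, and let $s$ be the number of vertices left unmatched by a matching of maximum size in the power graph $P(G)$. If $p$ is an odd prime with $p>s$, then the power graph $P(G\times C_p)$ has a perfect matching.
   Context: The power graph $P(H)$ of a finite group $H$ is the simple undirected graph with vertex set $H$ in which distinct $x,y$ are adjacent iff one is a power of the other. $C_p$ is the cyclic group of order $p$. A perfect matching is a set of pairwise vertex-disjoint edges covering every vertex. -}

module Defs where

open import Data.Nat using (ℕ; zero; suc; _+_; _*_; NonZero)
open import Data.Nat.DivMod using (_mod_)
open import Data.Fin using (Fin; toℕ)
open import Data.Product using (_×_; _,_; ∃)
open import Data.Sum using (_⊎_)
open import Data.List using (List; []; _∷_; length)
open import Data.List.Relation.Unary.All using (All)
open import Data.List.Relation.Unary.Unique.Propositional using (Unique)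
open import Data.List.Membership.Propositional using (_∈_)
open import Relation.Binary.PropositionalEquality using (_≡_; _≢_)
open import Algebra.Structures using (IsGroup)

-- A finite group, given (up to isomorphism) as a group structure on Fin order,
-- with propositional equality.
record FinGroup : Set where
  field
    order   : ℕ
    _∙_     : Fin order → Fin order → Fin order
    ε       : Fin order
    _⁻¹     : Fin order → Fin order
    isGroup : IsGroup _≡_ _∙_ ε _⁻¹

-- Natural-number powers x^k in a structure with an operation and identity.
-- (In a finite group, every integer power is a natural-number power.)
pow : {A : Set} → (A → A → A) → A → ℕ → A → A
pow _∙_ e zero    x = e
pow _∙_ e (suc k) x = x ∙ pow _∙_ e k x

IsPowerOf : {A : Set} → (A → A → A) → A → A → A → Set
IsPowerOf _∙_ e y x = ∃ λ k → y ≡ pow _∙_ e k x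

PowerAdj : {A : Set} → (A → A → A) → A → A → A → Set
PowerAdj _∙_ e x y = x ≢ y × (IsPowerOf _∙_ e y x ⊎ IsPowerOf _∙_ e x y)

endpoints : {A : Set} → List (A × A) → List A
endpoints []             = []
endpoints ((x , y) ∷ es) = x ∷ y ∷ endpoints es

record Matching {A : Set} (R : A → A → Set) : Set where
  field
    edges    : List (A × A)
    areEdges : All (λ e → R (Data.Product.proj₁ e) (Data.Product.proj₂ e)) edges
    disjoint : Unique (endpoints edges)

size : {A : Set} {R : A → A → Set} → Matching R → ℕ
size M = length (Matching.edges M)

IsPerfect : {A : Set} {R : A → A → Set} → Matching R → Set
IsPerfect {A} M = (v : A) → v ∈ endpoints (Matching.edges M)

IsMaximum : {A : Set} {R : A → A → Set} → Matching R → Set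
IsMaximum {R = R} M = (M' : Matching R) → size M' Data.Nat.≤ size M

PG : (G : FinGroup) → Fin (FinGroup.order G) → Fin (FinGroup.order G) → Set
PG G = PowerAdj (FinGroup._∙_ G) (FinGroup.ε G)

cycOp : (p : ℕ) .{{_ : NonZero p}} → Fin p → Fin p → Fin p
cycOp p a b = (toℕ a + toℕ b) mod p

cycId : (p : ℕ) .{{_ : NonZero p}} → Fin p
cycId p = 0 mod p

prodOp : (G : FinGroup) (p : ℕ) .{{_ : NonZero p}} →
         (Fin (FinGroup.order G) × Fin p) → (Fin (FinGroup.order G) × Fin p) →
         (Fin (FinGroup.order G) × Fin p)
prodOp G p (g , a) (h , b) = FinGroup._∙_ G g h , cycOp p a b

prodId : (G : FinGroup) (p : ℕ) .{{_ : NonZero p}} → Fin (FinGroup.order G) × Fin p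
prodId G p = FinGroup.ε G , cycId p

PGxC : (G : FinGroup) (p : ℕ) .{{_ : NonZero p}} →
       (Fin (FinGroup.order G) × Fin p) → (Fin (FinGroup.order G) × Fin p) → Set
PGxC G p = PowerAdj (prodOp G p) (prodId G p)

{-# OPTIONS --safe #-}
-- Call x ∈ G p-regular if its order is prime to p; as p is odd, every involution is p-regular.
-- Trading the edge through g⁻¹ for the edge {g, g⁻¹} turns a maximum matching of P(G) into one, μ,
-- whose t = |G| − 2|μ| uncovered vertices u₁, …, u_t are all p-regular; t is even, t < p, and the
-- identity ε is covered because it is adjacent to every vertex. Writing C_p additively, pair in
-- G × C_p
--   (g, 0) with (g′, 0) for every edge {g, g′} of μ,
--   (u_c, 0) with (u_c, c) and (u_c, −c) with (ε, c),
--   (ε, a) with (ε, p + t − a) for t < a < p,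
--   any other (g, a) with (g⁻¹, −a) if g is not p-regular, and with (g, −a) otherwise.
-- Since (g, a)^k = (g^k, k a), each pair is an edge of the power graph for a suitable exponent k
-- (for instance k ≡ 1 modulo the order of g and k ≡ −1 (mod p) gives (g, −a)), and the pairing is
-- a fixed-point-free involution, that is, a perfect matching.
module Submission where

open import Defs
open import Algebra.Bundles using (Group)
open import Algebra.Structures using (IsGroup)
import Algebra.Properties.Group as GroupProperties
open import Data.Nat
  using (ℕ; zero; suc; pred; _+_; _*_; _∸_; _≤_; _<_; _≤?_; _<?_; NonZero; z≤n; s≤s; z<s; s<s; ≢-nonZero)
open import Data.Nat.Properties
open import Data.Nat.DivMod
  using (_%_; _/_; _mod_; m%n<n; m≡m%n+[m/n]*n; %-distribˡ-+; m%n%n≡m%n; m*n%n≡0; n%n≡0; m<n⇒m%n≡m;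
         %-remove-+ʳ; [m+kn]%n≡m%n; [m+n]%n≡m%n)
open import Data.Nat.Divisibility
  using (_∣_; _∣?_; divides; ∣-reflexive; m%n≡0⇒n∣m; n∣m⇒m%n≡0; ∣m+n∣m⇒∣n; ∣m∣n⇒∣m+n; ∣m⇒∣m*n; ∣n⇒∣m*n; m∣m*n)
open import Data.Nat.Primality using (Prime; prime⇒nonZero)
open import Data.Nat.Coprimality using (prime⇒coprime; coprime-Bézout)
import Data.Nat.Coprimality as Coprimality
open import Data.Nat.GCD using (module Bézout)
open import Data.Nat.Tactic.RingSolver using (solve-∀)
open import Data.Fin using (Fin; toℕ; fromℕ<; combine; remQuot)
import Data.Fin.Properties as Fin
open import Data.Product using (_×_; _,_; ∃; Σ; proj₁; proj₂)
import Data.Product as Product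
open import Data.Sum using (_⊎_; inj₁; inj₂)
import Data.Sum as Sum
open import Data.List using (List; []; _∷_; _++_; length; filter; map; lookup; allFin; cartesianProduct)
open import Data.List.Properties using (length-++; length-tabulate)
open import Data.List.Relation.Unary.All using (All; []; _∷_)
import Data.List.Relation.Unary.All as All
open import Data.List.Relation.Unary.All.Properties using (¬Any⇒All¬; All¬⇒¬Any; map⁺)
open import Data.List.Relation.Unary.Any using (here; there; index)
open import Data.List.Relation.Unary.Any.Properties using (lookup-index)
open import Data.List.Relation.Unary.AllPairs using ([]; _∷_)
open import Data.List.Relation.Unary.Unique.Propositional using (Unique)
open import Data.List.Relation.Unary.Unique.Propositional.Properties
  using (Unique[x∷xs]⇒x∉xs; filter⁺; allFin⁺; ++⁺; cartesianProduct⁺)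
open import Data.List.Membership.Propositional using (_∈_; _∉_)
open import Data.List.Membership.Propositional.Properties
  using (∈-filter⁺; ∈-filter⁻; ∈-allFin; ∈-++⁺ˡ; ∈-++⁺ʳ; ∈-lookup; ∈-cartesianProduct⁺)
open import Data.List.Membership.Propositional.Properties.WithK using (unique⇒irrelevant; unique∧set⇒bag)
open import Data.List.Relation.Binary.BagAndSetEquality using (_∼[_]_; bag; ∼bag⇒↭)
open import Data.List.Relation.Binary.Permutation.Propositional.Properties using (↭-length)
open import Function using (_∘_; id)
open import Function.Bundles using (mk⇔)
open import Relation.Binary.Definitions using (DecidableEquality)
open import Relation.Binary.PropositionalEquality
open import Relation.Nullary using (¬_; ¬?; Dec; yes; no; contradiction)
open import Relation.Nullary.Decidable using (map′; _×-dec_; decidable-stable; dec-yes; dec-no; dec-yes-irr)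
open import Relation.Unary using (Decidable)

PowerAdj-sym : ∀ {A : Set} {_∙_ : A → A → A} {e x y} → PowerAdj _∙_ e x y → PowerAdj _∙_ e y x
PowerAdj-sym (x≢y , powers) = x≢y ∘ sym , Sum.swap powers

2∣m+m : ∀ m → 2 ∣ m + m
2∣m+m m = divides m (trans (cong (m +_) (sym (+-identityʳ m))) (*-comm 2 m))

index-∈-lookup : ∀ {A : Set} (xs : List A) i → index (∈-lookup {xs = xs} i) ≡ i
index-∈-lookup (_ ∷ _)  Data.Fin.zero    = refl
index-∈-lookup (_ ∷ xs) (Data.Fin.suc i) = cong Data.Fin.suc (index-∈-lookup xs i)

odd⇒n≡1+[n/2]*2 : ∀ {n} → ¬ 2 ∣ n → n ≡ suc (n / 2 * 2)
odd⇒n≡1+[n/2]*2 {n} 2∤n with n % 2 in n%2≡r | m%n<n n 2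
... | 0           | _               = contradiction (m%n≡0⇒n∣m n 2 n%2≡r) 2∤n
... | 1           | _               = trans (m≡m%n+[m/n]*n n 2) (cong (_+ n / 2 * 2) n%2≡r)
... | suc (suc _) | s<s (s<s ())

module Powers (G : FinGroup) where

  open FinGroup G
  open IsGroup isGroup using (assoc; identityˡ; identityʳ; inverseʳ)

  group : Group _ _
  group = record { isGroup = isGroup }

  open GroupProperties group using (∙-cancelʳ; inverseʳ-unique; ⁻¹-anti-homo-∙; ε⁻¹≈ε; ⁻¹-injective)

  infix 30 _^_
  _^_ : Fin order → ℕ → Fin order
  x ^ k = pow _∙_ ε k x

  ^-homo-+ : ∀ x m n → x ^ (m + n) ≡ x ^ m ∙ x ^ n
  ^-homo-+ x zero    n = sym (identityˡ _)
  ^-homo-+ x (suc m) n = trans (cong (x ∙_) (^-homo-+ x m n)) (sym (assoc _ _ _))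

  ^-assocˡ : ∀ x m n → (x ^ n) ^ m ≡ x ^ (m * n)
  ^-assocˡ x zero    n = refl
  ^-assocˡ x (suc m) n = trans (cong (x ^ n ∙_) (^-assocˡ x m n)) (sym (^-homo-+ x n (m * n)))

  ε^n≡ε : ∀ n → ε ^ n ≡ ε
  ε^n≡ε zero    = refl
  ε^n≡ε (suc n) = trans (cong (ε ∙_) (ε^n≡ε n)) (identityˡ ε)

  ^-sucʳ : ∀ x n → x ^ suc n ≡ x ^ n ∙ x
  ^-sucʳ x n = trans (cong (x ^_) (+-comm 1 n)) (trans (^-homo-+ x n 1) (cong (x ^ n ∙_) (identityʳ x)))

  ^-multiple≡ε : ∀ {x n} m → x ^ n ≡ ε → x ^ (m * n) ≡ ε
  ^-multiple≡ε {x} {n} m xⁿ≡ε = trans (sym (^-assocˡ x m n)) (trans (cong (_^ m) xⁿ≡ε) (ε^n≡ε m))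

  ⁻¹-^ : ∀ x n → (x ⁻¹) ^ n ≡ (x ^ n) ⁻¹
  ⁻¹-^ x zero    = sym ε⁻¹≈ε
  ⁻¹-^ x (suc n) = begin
    (x ⁻¹) ∙ (x ⁻¹) ^ n    ≡⟨ cong ((x ⁻¹) ∙_) (⁻¹-^ x n) ⟩
    (x ⁻¹) ∙ ((x ^ n) ⁻¹)  ≡⟨ ⁻¹-anti-homo-∙ (x ^ n) x ⟨
    (x ^ n ∙ x) ⁻¹         ≡⟨ cong _⁻¹ (^-sucʳ x n) ⟨
    (x ^ suc n) ⁻¹         ∎
    where open ≡-Reasoning

  torsion : ∀ x → ∃ λ d → x ^ suc d ≡ ε
  torsion x with i , j , i<j , xⁱ≡xʲ ← Fin.pigeonhole (n<1+n order) (λ i → x ^ toℕ i)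
    with d , i+1+d≡j ← m≤n⇒∃[o]m+o≡n i<j
    = d , ∙-cancelʳ (x ^ toℕ i) _ _ (begin
      x ^ suc d ∙ x ^ toℕ i  ≡⟨ ^-homo-+ x (suc d) (toℕ i) ⟨
      x ^ (suc d + toℕ i)    ≡⟨ cong (x ^_) (trans (+-comm (suc d) (toℕ i)) (trans (+-suc _ d) i+1+d≡j)) ⟩
      x ^ toℕ j              ≡⟨ xⁱ≡xʲ ⟨
      x ^ toℕ i              ≡⟨ identityˡ _ ⟨
      ε ∙ x ^ toℕ i          ∎)
    where open ≡-Reasoning

  ⁻¹-power : ∀ x → IsPowerOf _∙_ ε (x ⁻¹) x
  ⁻¹-power x with d , xᵈ⁺¹≡ε ← torsion x = d , sym (inverseʳ-unique x _ xᵈ⁺¹≡ε)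

  ⁻¹-adjacent : ∀ {x} → x ⁻¹ ≢ x → PowerAdj _∙_ ε x (x ⁻¹)
  ⁻¹-adjacent {x} x⁻¹≢x = x⁻¹≢x ∘ sym , inj₁ (⁻¹-power x)

  ⁻¹-power-≡-1 : ∀ p .{{_ : NonZero p}} x → ∃ λ j → p ∣ suc j × x ^ j ≡ x ⁻¹
  ⁻¹-power-≡-1 (suc p) x with d , xᵈ⁺¹≡ε ← torsion x =
    d + p * suc d , m∣m*n (suc d) , inverseʳ-unique x _ (^-multiple≡ε {x} {suc d} (suc p) xᵈ⁺¹≡ε)

  -- x^j = ε for some j ≡ −1 (mod p): the order of x is prime to p.
  PRegular : ℕ → Fin order → Set
  PRegular p x = ∃ λ j → p ∣ suc j × x ^ j ≡ ε

  PRegular-witness-% : ∀ {p x j} N .{{_ : NonZero N}} → p ∣ N → x ^ N ≡ ε →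
                       p ∣ suc j → x ^ j ≡ ε → p ∣ suc (j % N) × x ^ (j % N) ≡ ε
  PRegular-witness-% {p} {x} {j} N p∣N xᴺ≡ε p∣1+j xʲ≡ε =
    ∣m+n∣m⇒∣n (subst (p ∣_) (trans (cong suc j≡r+qN) (+-comm (suc r) (q * N))) p∣1+j) (∣n⇒∣m*n q p∣N) ,
    (begin
      x ^ r                ≡⟨ identityʳ (x ^ r) ⟨
      x ^ r ∙ ε            ≡⟨ cong (x ^ r ∙_) (^-multiple≡ε q xᴺ≡ε) ⟨
      x ^ r ∙ x ^ (q * N)  ≡⟨ ^-homo-+ x r (q * N) ⟨
      x ^ (r + q * N)      ≡⟨ cong (x ^_) j≡r+qN ⟨
      x ^ j                ≡⟨ xʲ≡ε ⟩
      ε                    ∎)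
    where
    open ≡-Reasoning
    r = j % N
    q = j / N
    j≡r+qN : j ≡ r + q * N
    j≡r+qN = m≡m%n+[m/n]*n j N

  PRegular? : ∀ p .{{_ : NonZero p}} x → Dec (PRegular p x)
  PRegular? (suc p) x with d , xᵈ⁺¹≡ε ← torsion x =
    map′ (λ (j , w) → toℕ j , w) bounded
         (Fin.any? λ (j : Fin N) → suc p ∣? suc (toℕ j) ×-dec x ^ toℕ j Fin.≟ ε)
    where
    N = suc p * suc d
    bounded : PRegular (suc p) x → ∃ λ (j : Fin N) → suc p ∣ suc (toℕ j) × x ^ toℕ j ≡ ε
    bounded (j , p∣1+j , xʲ≡ε) =
      fromℕ< (m%n<n j N) ,
      subst (λ i → suc p ∣ suc i × x ^ i ≡ ε) (sym (Fin.toℕ-fromℕ< (m%n<n j N)))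
            (PRegular-witness-% N (m∣m*n (suc d)) (^-multiple≡ε {x} {suc d} (suc p) xᵈ⁺¹≡ε)
                                p∣1+j xʲ≡ε)

  involution⇒PRegular : ∀ {p} → ¬ 2 ∣ p → ∀ {x} → x ∙ x ≡ ε → PRegular p x
  involution⇒PRegular {p} 2∤p {x} x²≡ε =
    p / 2 * 2 , ∣-reflexive (odd⇒n≡1+[n/2]*2 2∤p) ,
    ^-multiple≡ε (p / 2) (trans (cong (x ∙_) (identityʳ x)) x²≡ε)

  ⁻¹-fixed⇒PRegular : ∀ {p} → ¬ 2 ∣ p → ∀ {x} → x ⁻¹ ≡ x → PRegular p x
  ⁻¹-fixed⇒PRegular 2∤p {x} x⁻¹≡x =
    involution⇒PRegular 2∤p (trans (cong (x ∙_) (sym x⁻¹≡x)) (inverseʳ x))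

  PRegular-⁻¹ : ∀ {p x} → PRegular p (x ⁻¹) → PRegular p x
  PRegular-⁻¹ {x = x} (j , p∣1+j , x⁻ʲ≡ε) =
    j , p∣1+j , ⁻¹-injective (trans (sym (⁻¹-^ x j)) (trans x⁻ʲ≡ε (sym ε⁻¹≈ε)))

module Residues (p : ℕ) .{{_ : NonZero p}} where

  [m+n%p]%p≡[m+n]%p : ∀ m n → (m + n % p) % p ≡ (m + n) % p
  [m+n%p]%p≡[m+n]%p m n = begin
    (m + n % p) % p           ≡⟨ %-distribˡ-+ m (n % p) p ⟩
    (m % p + n % p % p) % p   ≡⟨ cong (λ k → (m % p + k) % p) (m%n%n≡m%n n p) ⟩
    (m % p + n % p) % p       ≡⟨ %-distribˡ-+ m n p ⟨
    (m + n) % p               ∎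
    where open ≡-Reasoning

  [k*c]%p≡[p∸c]%p : ∀ {k} c → p ∣ suc k → c ≤ p → (k * c) % p ≡ (p ∸ c) % p
  [k*c]%p≡[p∸c]%p {k} c p∣1+k c≤p = begin
    (k * c) % p                 ≡⟨ [m+n]%n≡m%n (k * c) p ⟨
    (k * c + p) % p             ≡⟨ cong (λ n → (k * c + n) % p) (m∸n+n≡m c≤p) ⟨
    (k * c + (p ∸ c + c)) % p   ≡⟨ cong (_% p) (rearrange (k * c) (p ∸ c) c) ⟩
    (p ∸ c + (k * c + c)) % p   ≡⟨ %-remove-+ʳ (p ∸ c) p∣kc+c ⟩
    (p ∸ c) % p                 ∎
    where
    open ≡-Reasoning
    rearrange : ∀ x y z → x + (y + z) ≡ y + (x + z)
    rearrange = solve-∀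
    p∣kc+c : p ∣ k * c + c
    p∣kc+c = subst (p ∣_) (+-comm c (k * c)) (∣m⇒∣m*n c p∣1+k)

  toℕ-mod : ∀ m → toℕ (m mod p) ≡ m % p
  toℕ-mod m = Fin.toℕ-fromℕ< (m%n<n m p)

  0ₚ : Fin p
  0ₚ = cycId p

  toℕ-0ₚ : toℕ 0ₚ ≡ 0
  toℕ-0ₚ = trans (toℕ-mod 0) (m*n%n≡0 0 p)

  ≢0ₚ⇒toℕ≢0 : ∀ {a} → a ≢ 0ₚ → toℕ a ≢ 0
  ≢0ₚ⇒toℕ≢0 a≢0 toℕa≡0 = a≢0 (Fin.toℕ-injective (trans toℕa≡0 (sym toℕ-0ₚ)))

  infix 9 -_
  -_ : Fin p → Fin p
  - a = (p ∸ toℕ a) mod p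

  infix 8 _·_
  _·_ : ℕ → Fin p → Fin p
  k · a = pow (cycOp p) (cycId p) k a

  toℕ-· : ∀ k a → toℕ (k · a) ≡ (k * toℕ a) % p
  toℕ-· zero    a = toℕ-mod 0
  toℕ-· (suc k) a = begin
    toℕ ((toℕ a + toℕ (k · a)) mod p)  ≡⟨ toℕ-mod _ ⟩
    (toℕ a + toℕ (k · a)) % p          ≡⟨ cong (λ n → (toℕ a + n) % p) (toℕ-· k a) ⟩
    (toℕ a + (k * toℕ a) % p) % p      ≡⟨ [m+n%p]%p≡[m+n]%p (toℕ a) (k * toℕ a) ⟩
    (toℕ a + k * toℕ a) % p            ∎
    where open ≡-Reasoning

  ·-zeroʳ : ∀ k → k · 0ₚ ≡ 0ₚ
  ·-zeroʳ k = Fin.toℕ-injective (begin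
    toℕ (k · 0ₚ)       ≡⟨ toℕ-· k 0ₚ ⟩
    (k * toℕ 0ₚ) % p   ≡⟨ cong (λ n → (k * n) % p) toℕ-0ₚ ⟩
    (k * 0) % p        ≡⟨ cong (_% p) (*-zeroʳ k) ⟩
    0 % p              ≡⟨ toℕ-mod 0 ⟨
    toℕ 0ₚ             ∎)
    where open ≡-Reasoning

  ∣⇒·≡0ₚ : ∀ {k} a → p ∣ k → k · a ≡ 0ₚ
  ∣⇒·≡0ₚ {k} a p∣k = Fin.toℕ-injective (begin
    toℕ (k · a)        ≡⟨ toℕ-· k a ⟩
    (k * toℕ a) % p    ≡⟨ n∣m⇒m%n≡0 (k * toℕ a) p (∣m⇒∣m*n (toℕ a) p∣k) ⟩
    0                  ≡⟨ toℕ-0ₚ ⟨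
    toℕ 0ₚ             ∎)
    where open ≡-Reasoning

  ∣suc⇒·≡- : ∀ {k} a → p ∣ suc k → k · a ≡ - a
  ∣suc⇒·≡- {k} a p∣1+k = Fin.toℕ-injective (begin
    toℕ (k · a)        ≡⟨ toℕ-· k a ⟩
    (k * toℕ a) % p    ≡⟨ [k*c]%p≡[p∸c]%p (toℕ a) p∣1+k (<⇒≤ (Fin.toℕ<n a)) ⟩
    (p ∸ toℕ a) % p    ≡⟨ toℕ-mod _ ⟨
    toℕ (- a)          ∎)
    where open ≡-Reasoning

  -‿involutive : ∀ a → - (- a) ≡ a
  -‿involutive a = Fin.toℕ-injective (begin
    toℕ (- (- a))                  ≡⟨ toℕ-mod _ ⟩
    (p ∸ toℕ (- a)) % p            ≡⟨ cong (λ n → (p ∸ n) % p) (toℕ-mod _) ⟩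
    (p ∸ (p ∸ toℕ a) % p) % p      ≡⟨ p∸[p∸n]%p (toℕ a) (Fin.toℕ<n a) ⟩
    toℕ a                          ∎)
    where
    open ≡-Reasoning
    p∸[p∸n]%p : ∀ n → n < p → (p ∸ (p ∸ n) % p) % p ≡ n
    p∸[p∸n]%p zero    _   = trans (cong (λ m → (p ∸ m) % p) (n%n≡0 p)) (n%n≡0 p)
    p∸[p∸n]%p (suc n) n<p = begin
      (p ∸ (p ∸ suc n) % p) % p
        ≡⟨ cong (λ m → (p ∸ m) % p) (m<n⇒m%n≡m (∸-monoʳ-< z<s (<⇒≤ n<p))) ⟩
      (p ∸ (p ∸ suc n)) % p      ≡⟨ cong (_% p) (m∸[m∸n]≡n (<⇒≤ n<p)) ⟩
      suc n % p                  ≡⟨ m<n⇒m%n≡m n<p ⟩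
      suc n                      ∎

  -‿injective : ∀ {a b} → - a ≡ - b → a ≡ b
  -‿injective {a} {b} -a≡-b = trans (sym (-‿involutive a)) (trans (cong -_ -a≡-b) (-‿involutive b))

  -0ₚ≡0ₚ : - 0ₚ ≡ 0ₚ
  -0ₚ≡0ₚ = Fin.toℕ-injective (begin
    toℕ (- 0ₚ)          ≡⟨ toℕ-mod _ ⟩
    (p ∸ toℕ 0ₚ) % p    ≡⟨ cong (λ n → (p ∸ n) % p) toℕ-0ₚ ⟩
    p % p               ≡⟨ n%n≡0 p ⟩
    0                   ≡⟨ toℕ-0ₚ ⟨
    toℕ 0ₚ              ∎)
    where open ≡-Reasoning

  -‿≢0ₚ : ∀ {a} → a ≢ 0ₚ → - a ≢ 0ₚ
  -‿≢0ₚ {a} a≢0 -a≡0 = a≢0 (trans (sym (-‿involutive a)) (trans (cong -_ -a≡0) -0ₚ≡0ₚ))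

  -‿≢self : ¬ 2 ∣ p → ∀ {a} → a ≢ 0ₚ → - a ≢ a
  -‿≢self 2∤p {a} a≢0 -a≡a = 2∤p (subst (2 ∣_) a+a≡p (2∣m+m (toℕ a)))
    where
    open ≡-Reasoning
    a≤p : toℕ a ≤ p
    a≤p = <⇒≤ (Fin.toℕ<n a)
    a+a≡p : toℕ a + toℕ a ≡ p
    a+a≡p = begin
      toℕ a + toℕ a          ≡⟨ cong (_+ toℕ a) (cong toℕ -a≡a) ⟨
      toℕ (- a) + toℕ a      ≡⟨ cong (_+ toℕ a) (toℕ-mod _) ⟩
      (p ∸ toℕ a) % p + toℕ a
        ≡⟨ cong (_+ toℕ a) (m<n⇒m%n≡m (∸-monoʳ-< (n≢0⇒n>0 (≢0ₚ⇒toℕ≢0 a≢0)) a≤p)) ⟩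
      p ∸ toℕ a + toℕ a      ≡⟨ m∸n+n≡m a≤p ⟩
      p                      ∎

  ·-surjective : Prime p → ∀ {a} → a ≢ 0ₚ → ∀ b → ∃ λ k → k · a ≡ b
  ·-surjective p-prime {a} a≢0 b
    with coprime-Bézout (Coprimality.sym
           (prime⇒coprime p-prime {{≢-nonZero (≢0ₚ⇒toℕ≢0 a≢0)}} (Fin.toℕ<n a)))
  ... | Bézout.+- x y 1+yp≡xa = toℕ b * x , Fin.toℕ-injective (begin
    toℕ ((toℕ b * x) · a)              ≡⟨ toℕ-· (toℕ b * x) a ⟩
    (toℕ b * x * toℕ a) % p            ≡⟨ cong (_% p) (*-assoc (toℕ b) x (toℕ a)) ⟩
    (toℕ b * (x * toℕ a)) % p          ≡⟨ cong (λ n → (toℕ b * n) % p) 1+yp≡xa ⟨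
    (toℕ b * (1 + y * p)) % p          ≡⟨ cong (_% p) (expand (toℕ b) y p) ⟩
    (toℕ b + toℕ b * y * p) % p        ≡⟨ [m+kn]%n≡m%n (toℕ b) (toℕ b * y) p ⟩
    toℕ b % p                          ≡⟨ m<n⇒m%n≡m (Fin.toℕ<n b) ⟩
    toℕ b                              ∎)
    where
    open ≡-Reasoning
    expand : ∀ b y p → b * (1 + y * p) ≡ b + b * y * p
    expand = solve-∀
  ... | Bézout.-+ x y 1+xa≡yp = x * (p ∸ toℕ b) , Fin.toℕ-injective (begin
    toℕ ((x * (p ∸ toℕ b)) · a)        ≡⟨ toℕ-· (x * (p ∸ toℕ b)) a ⟩
    (x * (p ∸ toℕ b) * toℕ a) % p      ≡⟨ cong (_% p) (swap x (p ∸ toℕ b) (toℕ a)) ⟩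
    (x * toℕ a * (p ∸ toℕ b)) % p
      ≡⟨ [k*c]%p≡[p∸c]%p (p ∸ toℕ b) (divides y 1+xa≡yp) (m∸n≤m p (toℕ b)) ⟩
    (p ∸ (p ∸ toℕ b)) % p              ≡⟨ cong (_% p) (m∸[m∸n]≡n (<⇒≤ (Fin.toℕ<n b))) ⟩
    toℕ b % p                          ≡⟨ m<n⇒m%n≡m (Fin.toℕ<n b) ⟩
    toℕ b                              ∎)
    where
    open ≡-Reasoning
    swap : ∀ x c a → x * c * a ≡ x * a * c
    swap = solve-∀

  module Mirror (t : ℕ) where

    mirror : Fin p → Fin p
    mirror a = (p + t ∸ toℕ a) mod p

    module _ {a : Fin p} (t<a : t < toℕ a) where

      private
        a≤p+t : toℕ a ≤ p + t
        a≤p+t = ≤-trans (<⇒≤ (Fin.toℕ<n a)) (m≤m+n p t)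

      toℕ-mirror : toℕ (mirror a) ≡ p + t ∸ toℕ a
      toℕ-mirror =
        trans (toℕ-mod _) (m<n⇒m%n≡m (subst (p + t ∸ toℕ a <_) (m+n∸n≡m p t) (∸-monoʳ-< t<a a≤p+t)))

      t<mirror : t < toℕ (mirror a)
      t<mirror = subst₂ _<_ (m+n∸m≡n p t) (sym toℕ-mirror) (∸-monoʳ-< (Fin.toℕ<n a) (m≤m+n p t))

      mirror-involutive : mirror (mirror a) ≡ a
      mirror-involutive = Fin.toℕ-injective (begin
        toℕ (mirror (mirror a))        ≡⟨ toℕ-mod _ ⟩
        (p + t ∸ toℕ (mirror a)) % p   ≡⟨ cong (λ n → (p + t ∸ n) % p) toℕ-mirror ⟩
        (p + t ∸ (p + t ∸ toℕ a)) % p  ≡⟨ cong (_% p) (m∸[m∸n]≡n a≤p+t) ⟩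
        toℕ a % p                      ≡⟨ m<n⇒m%n≡m (Fin.toℕ<n a) ⟩
        toℕ a                          ∎)
        where open ≡-Reasoning

      mirror-≢ : ¬ 2 ∣ p + t → mirror a ≢ a
      mirror-≢ 2∤p+t mirror≡a = 2∤p+t (subst (2 ∣_) a+a≡p+t (2∣m+m (toℕ a)))
        where
        a+a≡p+t : toℕ a + toℕ a ≡ p + t
        a+a≡p+t = trans (cong (_+ toℕ a) (trans (sym (cong toℕ mirror≡a)) toℕ-mirror)) (m∸n+n≡m a≤p+t)

module ProductPowers (G : FinGroup) (p : ℕ) .{{_ : NonZero p}} where

  open FinGroup G
  open IsGroup isGroup using (identityˡ; identityʳ)
  open Powers G
  open Residues p

  infix 4 _∈⟨_⟩
  _∈⟨_⟩ : Fin order × Fin p → Fin order × Fin p → Set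
  y ∈⟨ x ⟩ = IsPowerOf (prodOp G p) (prodId G p) y x

  pow-prod : ∀ k g a → pow (prodOp G p) (prodId G p) k (g , a) ≡ (g ^ k , k · a)
  pow-prod zero    g a = refl
  pow-prod (suc k) g a = cong (prodOp G p (g , a)) (pow-prod k g a)

  ∈⟨⟩-intro : ∀ {g h a b} k → h ≡ g ^ k → b ≡ k · a → (h , b) ∈⟨ (g , a) ⟩
  ∈⟨⟩-intro {g} {a = a} k h≡gᵏ b≡k·a = k , trans (cong₂ _,_ h≡gᵏ b≡k·a) (sym (pow-prod k g a))

  inverse∈⟨⟩ : ∀ g a → (g ⁻¹ , - a) ∈⟨ (g , a) ⟩
  inverse∈⟨⟩ g a with j , p∣1+j , gʲ≡g⁻¹ ← ⁻¹-power-≡-1 p g =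
    ∈⟨⟩-intro j (sym gʲ≡g⁻¹) (sym (∣suc⇒·≡- a p∣1+j))

  layer₀∈⟨⟩ : ∀ {g h} → IsPowerOf _∙_ ε h g → (h , 0ₚ) ∈⟨ (g , 0ₚ) ⟩
  layer₀∈⟨⟩ (k , h≡gᵏ) = ∈⟨⟩-intro k h≡gᵏ (sym (·-zeroʳ k))

  ε-column∈⟨⟩ : Prime p → ∀ {a} → a ≢ 0ₚ → ∀ b → (ε , b) ∈⟨ (ε , a) ⟩
  ε-column∈⟨⟩ p-prime a≢0 b with k , k·a≡b ← ·-surjective p-prime a≢0 b =
    ∈⟨⟩-intro k (sym (ε^n≡ε k)) (sym k·a≡b)

  module _ {g} (g-regular : PRegular p g) where

    private
      j = proj₁ g-regular
      p∣1+j = proj₁ (proj₂ g-regular)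
      gʲ≡ε = proj₂ (proj₂ g-regular)

      gʲ⁺¹≡g : g ^ suc j ≡ g
      gʲ⁺¹≡g = trans (cong (g ∙_) gʲ≡ε) (identityʳ g)

    regular⇒negation∈⟨⟩ : ∀ a → (g , - a) ∈⟨ (g , a) ⟩
    regular⇒negation∈⟨⟩ a = ∈⟨⟩-intro (j + suc j)
      (sym (trans (^-homo-+ g j (suc j)) (trans (cong₂ _∙_ gʲ≡ε gʲ⁺¹≡g) (identityˡ g))))
      (sym (∣suc⇒·≡- a (∣m∣n⇒∣m+n p∣1+j p∣1+j)))

    regular⇒zero∈⟨⟩ : ∀ a → (g , 0ₚ) ∈⟨ (g , a) ⟩
    regular⇒zero∈⟨⟩ a = ∈⟨⟩-intro (suc j) (sym gʲ⁺¹≡g) (sym (∣⇒·≡0ₚ a p∣1+j))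

    regular⇒ε∈⟨⟩ : ∀ a → (ε , a) ∈⟨ (g , - a) ⟩
    regular⇒ε∈⟨⟩ a =
      ∈⟨⟩-intro j (sym gʲ≡ε) (sym (trans (∣suc⇒·≡- (- a) p∣1+j) (-‿involutive a)))

module _ {A : Set} where

  length-endpoints : ∀ (es : List (A × A)) → length (endpoints es) ≡ 2 * length es
  length-endpoints []       = refl
  length-endpoints (_ ∷ es) = trans (cong (suc ∘ suc) (length-endpoints es)) (sym (*-suc 2 (length es)))

  ∃-other-member : ∀ {xs : List A} {z} → Unique xs → 2 ∣ length xs → z ∈ xs → ∃ λ y → y ∈ xs × y ≢ z
  ∃-other-member {_ ∷ []}    _                 (divides zero    ()) _
  ∃-other-member {_ ∷ []}    _                 (divides (suc _) ()) _
  ∃-other-member {_ ∷ _ ∷ _} ((x≢y ∷ _) ∷ _)  _ (here refl) = _ , there (here refl) , x≢y ∘ sym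
  ∃-other-member {_ ∷ _ ∷ _} unique           _ (there z∈)  =
    _ , here refl , λ x≡z → Unique[x∷xs]⇒x∉xs unique (subst (_∈ _) (sym x≡z) z∈)

  module _ {R : A → A → Set} where

    Covered : Matching R → A → Set
    Covered M x = x ∈ endpoints (Matching.edges M)

    uncovered-nonadjacent : ∀ {M} → IsMaximum M →
                            ∀ {x y} → ¬ Covered M x → ¬ Covered M y → x ≢ y → ¬ R x y
    uncovered-nonadjacent {M} M-max {x} {y} x∉ y∉ x≢y Rxy = 1+n≰n (M-max extended)
      where
      extended : Matching R
      extended = record
        { edges    = (x , y) ∷ Matching.edges M
        ; areEdges = Rxy ∷ Matching.areEdges M
        ; disjoint = ¬Any⇒All¬ _ (λ { (here x≡y) → x≢y x≡y ; (there x∈) → x∉ x∈ })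
                   ∷ ¬Any⇒All¬ _ y∉
                   ∷ Matching.disjoint M
        }

  module Mates (_≟_ : DecidableEquality A) where

    mate : List (A × A) → A → A
    mate []             x = x
    mate ((a , b) ∷ es) x with x ≟ a
    ... | yes _ = b
    ... | no  _ with x ≟ b
    ...   | yes _ = a
    ...   | no  _ = mate es x

    mate-cases : ∀ es x → mate es x ≡ x ⊎ mate es x ∈ endpoints es
    mate-cases []             x = inj₁ refl
    mate-cases ((a , b) ∷ es) x with x ≟ a
    ... | yes _ = inj₂ (there (here refl))
    ... | no  _ with x ≟ b
    ...   | yes _ = inj₂ (here refl)
    ...   | no  _ with mate-cases es x
    ...     | inj₁ fixed = inj₁ fixed
    ...     | inj₂ m∈    = inj₂ (there (there m∈))

    mate-avoids : ∀ es {x c} → x ≢ c → c ∉ endpoints es → mate es x ≢ c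
    mate-avoids es {x} x≢c c∉ y≡c with mate-cases es x
    ... | inj₁ y≡x = x≢c (trans (sym y≡x) y≡c)
    ... | inj₂ y∈  = c∉ (subst (_∈ endpoints es) y≡c y∈)

    mate-edge : ∀ es {x} → x ∈ endpoints es → (x , mate es x) ∈ es ⊎ (mate es x , x) ∈ es
    mate-edge ((a , b) ∷ es) {x} x∈ with x ≟ a
    ... | yes refl = inj₁ (here refl)
    ... | no  x≢a with x ≟ b
    ...   | yes refl = inj₂ (here refl)
    ...   | no  x≢b with x∈
    ...     | here x≡a         = contradiction x≡a x≢a
    ...     | there (here x≡b) = contradiction x≡b x≢b
    ...     | there (there x∈) with mate-edge es x∈
    ...       | inj₁ e = inj₁ (there e)
    ...       | inj₂ e = inj₂ (there e)

    mate-involutive : ∀ es → Unique (endpoints es) → ∀ x → mate es (mate es x) ≡ x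
    mate-involutive []             _ x = refl
    mate-involutive ((a , b) ∷ es) unique@(_ ∷ b∉ ∷ unique-es) x with x ≟ a
    ... | yes refl with b ≟ x
    ...   | yes refl = contradiction (here refl) (Unique[x∷xs]⇒x∉xs unique)
    ...   | no  _ with b ≟ b
    ...     | yes _   = refl
    ...     | no  b≢b = contradiction refl b≢b
    mate-involutive ((a , b) ∷ es) unique@(_ ∷ b∉ ∷ unique-es) x | no x≢a with x ≟ b
    ...   | yes refl with a ≟ a
    ...     | yes _   = refl
    ...     | no  a≢a = contradiction refl a≢a
    mate-involutive ((a , b) ∷ es) unique@(_ ∷ b∉ ∷ unique-es) x | no x≢a | no x≢b
      with mate es x ≟ a
    ... | yes y≡a = contradiction y≡a (mate-avoids es x≢a (λ a∈ → Unique[x∷xs]⇒x∉xs unique (there a∈)))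
    ... | no  _ with mate es x ≟ b
    ...   | yes y≡b = contradiction y≡b (mate-avoids es x≢b (Unique[x∷xs]⇒x∉xs (b∉ ∷ unique-es)))
    ...   | no  _   = mate-involutive es unique-es x

    mate-∈ : ∀ es {x} → x ∈ endpoints es → mate es x ∈ endpoints es
    mate-∈ es {x} x∈ with mate-cases es x
    ... | inj₁ y≡x = subst (_∈ endpoints es) (sym y≡x) x∈
    ... | inj₂ y∈  = y∈

  module Rerouting (_≟_ : DecidableEquality A) (ι : A → A) (ι-involutive : ∀ x → ι (ι x) ≡ x) where

    ι-injective : ∀ {y z} → ι y ≡ ι z → y ≡ z
    ι-injective {y} {z} ιy≡ιz = trans (sym (ι-involutive y)) (trans (cong ι ιy≡ιz) (ι-involutive z))

    misfits : List (A × A) → ℕ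
    misfits []             = 0
    misfits ((a , b) ∷ es) with b ≟ ι a
    ... | yes _ = misfits es
    ... | no  _ = suc (misfits es)

    reroute : ∀ x es → ι x ∈ endpoints es → List (A × A)
    reroute x ((a , b) ∷ es) (here _)         = (x , a) ∷ es
    reroute x ((a , b) ∷ es) (there (here _)) = (x , b) ∷ es
    reroute x (e ∷ es)       (there (there m)) = e ∷ reroute x es m

    reroute-length : ∀ x es m → length (reroute x es m) ≡ length es
    reroute-length x (_ ∷ es) (here _)          = refl
    reroute-length x (_ ∷ es) (there (here _))  = refl
    reroute-length x (_ ∷ es) (there (there m)) = cong suc (reroute-length x es m)

    reroute-edges : ∀ {R : A → A → Set} x es m → R x (ι x) →
                    All (λ e → R (proj₁ e) (proj₂ e)) es →
                    All (λ e → R (proj₁ e) (proj₂ e)) (reroute x es m)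
    reroute-edges {R} x (_ ∷ es) (here ιx≡a)         Rxιx (_ ∷ rs) = subst (R x) ιx≡a Rxιx ∷ rs
    reroute-edges {R} x (_ ∷ es) (there (here ιx≡b)) Rxιx (_ ∷ rs) = subst (R x) ιx≡b Rxιx ∷ rs
    reroute-edges     x (_ ∷ es) (there (there m))   Rxιx (r ∷ rs) = r ∷ reroute-edges x es m Rxιx rs

    reroute-endpoints : ∀ x es m {z} → z ∈ endpoints (reroute x es m) → z ≡ x ⊎ z ∈ endpoints es
    reroute-endpoints x (_ ∷ es) (here _)          (here z≡x)          = inj₁ z≡x
    reroute-endpoints x (_ ∷ es) (here _)          (there (here z≡a))  = inj₂ (here z≡a)
    reroute-endpoints x (_ ∷ es) (here _)          (there (there z∈))  = inj₂ (there (there z∈))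
    reroute-endpoints x (_ ∷ es) (there (here _))  (here z≡x)          = inj₁ z≡x
    reroute-endpoints x (_ ∷ es) (there (here _))  (there z∈)          = inj₂ (there z∈)
    reroute-endpoints x (_ ∷ es) (there (there m)) (here z≡a)          = inj₂ (here z≡a)
    reroute-endpoints x (_ ∷ es) (there (there m)) (there (here z≡b))  = inj₂ (there (here z≡b))
    reroute-endpoints x (_ ∷ es) (there (there m)) (there (there z∈)) with reroute-endpoints x es m z∈
    ... | inj₁ z≡x = inj₁ z≡x
    ... | inj₂ z∈′ = inj₂ (there (there z∈′))

    reroute-unique : ∀ x es m → x ∉ endpoints es → Unique (endpoints es) →
                     Unique (endpoints (reroute x es m))
    reroute-unique x (_ ∷ es) (here _) x∉ ((_ ∷ a∉) ∷ _ ∷ unique) =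
      ¬Any⇒All¬ _ (λ { (here x≡a) → x∉ (here x≡a) ; (there x∈) → x∉ (there (there x∈)) })
      ∷ a∉ ∷ unique
    reroute-unique x (_ ∷ es) (there (here _)) x∉ (_ ∷ unique) =
      ¬Any⇒All¬ _ (x∉ ∘ there) ∷ unique
    reroute-unique x ((a , b) ∷ es) (there (there m)) x∉ ((a≢b ∷ a∉) ∷ b∉ ∷ unique) =
      (a≢b ∷ ¬Any⇒All¬ _ (fresh (x∉ ∘ here ∘ sym) (All¬⇒¬Any a∉)))
      ∷ ¬Any⇒All¬ _ (fresh (x∉ ∘ there ∘ here ∘ sym) (All¬⇒¬Any b∉))
      ∷ reroute-unique x es m (x∉ ∘ there ∘ there) unique
      where
      fresh : ∀ {c} → c ≢ x → c ∉ endpoints es → c ∉ endpoints (reroute x es m)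
      fresh c≢x c∉ c∈ with reroute-endpoints x es m c∈
      ... | inj₁ c≡x = c≢x c≡x
      ... | inj₂ c∈′ = c∉ c∈′

    reroute-misfits : ∀ x es m → x ∉ endpoints es → suc (misfits (reroute x es m)) ≡ misfits es
    reroute-misfits x ((a , b) ∷ es) (here ιx≡a) x∉ with a ≟ ι x | b ≟ ι a
    ... | no a≢ιx | _       = contradiction (sym ιx≡a) a≢ιx
    ... | yes _   | yes b≡ιa =
      contradiction (there (here (sym (trans b≡ιa (trans (cong ι (sym ιx≡a)) (ι-involutive x)))))) x∉
    ... | yes _   | no  _   = refl
    reroute-misfits x ((a , b) ∷ es) (there (here ιx≡b)) x∉ with b ≟ ι x | b ≟ ι a
    ... | no b≢ιx | _       = contradiction (sym ιx≡b) b≢ιx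
    ... | yes _   | yes b≡ιa = contradiction (here (ι-injective (trans ιx≡b b≡ιa))) x∉
    ... | yes _   | no  _   = refl
    reroute-misfits x ((a , b) ∷ es) (there (there m)) x∉ with b ≟ ι a
    ... | yes _ = reroute-misfits x es m (x∉ ∘ there ∘ there)
    ... | no  _ = cong suc (reroute-misfits x es m (x∉ ∘ there ∘ there))

module FiniteGraph {n : ℕ} {R : Fin n → Fin n → Set} where

  open import Data.List.Membership.DecPropositional (Fin._≟_ {n}) using (_∈?_)

  covered? : ∀ (M : Matching R) x → Dec (Covered M x)
  covered? M x = x ∈? endpoints (Matching.edges M)

  uncovered : Matching R → List (Fin n)
  uncovered M = filter (¬? ∘ covered? M) (allFin n)

  ∈-uncovered⁺ : ∀ {M : Matching R} {x} → ¬ Covered M x → x ∈ uncovered M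
  ∈-uncovered⁺ {M} {x} x∉ = ∈-filter⁺ (¬? ∘ covered? M) (∈-allFin x) x∉

  ∈-uncovered⁻ : ∀ {M : Matching R} {x} → x ∈ uncovered M → ¬ Covered M x
  ∈-uncovered⁻ {M} x∈ = proj₂ (∈-filter⁻ (¬? ∘ covered? M) {xs = allFin n} x∈)

  uncovered-unique : ∀ (M : Matching R) → Unique (uncovered M)
  uncovered-unique M = filter⁺ (¬? ∘ covered? M) (allFin⁺ n)

  length-uncovered+2*size : ∀ (M : Matching R) → length (uncovered M) + 2 * size M ≡ n
  length-uncovered+2*size M = begin
    length (uncovered M) + 2 * size M              ≡⟨ cong (length (uncovered M) +_) (length-endpoints es) ⟨
    length (uncovered M) + length (endpoints es)   ≡⟨ length-++ (uncovered M) ⟨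
    length (uncovered M ++ endpoints es)           ≡⟨ ↭-length (∼bag⇒↭ partition) ⟨
    length (allFin n)                              ≡⟨ length-tabulate id ⟩
    n                                              ∎
    where
    open ≡-Reasoning
    es = Matching.edges M
    partition : allFin n ∼[ bag ] uncovered M ++ endpoints es
    partition = unique∧set⇒bag (allFin⁺ n)
      (++⁺ (uncovered-unique M) (Matching.disjoint M) (λ (x∈U , x∈E) → ∈-uncovered⁻ {M} x∈U x∈E))
      (λ {x} → mk⇔ (λ _ → split x) (λ _ → ∈-allFin x))
      where
      split : ∀ x → x ∈ uncovered M ++ endpoints es
      split x with covered? M x
      ... | yes x∈E = ∈-++⁺ʳ (uncovered M) x∈E
      ... | no  x∉E = ∈-++⁺ˡ (∈-uncovered⁺ {M} x∉E)

  length-uncovered : ∀ (M : Matching R) → length (uncovered M) ≡ n ∸ 2 * size M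
  length-uncovered M =
    trans (sym (m+n∸n≡m (length (uncovered M)) (2 * size M)))
          (cong (_∸ 2 * size M) (length-uncovered+2*size M))

  uncovered-even : ∀ (M : Matching R) → 2 ∣ n → 2 ∣ length (uncovered M)
  uncovered-even M 2∣n =
    ∣m+n∣m⇒∣n (subst (2 ∣_) (trans (sym (length-uncovered+2*size M)) (+-comm _ (2 * size M))) 2∣n)
              (m∣m*n (size M))

  universal⇒covered : ∀ {M : Matching R} → IsMaximum M → 2 ∣ length (uncovered M) →
                      ∀ {z} → (∀ {y} → y ≢ z → R y z) → Covered M z
  universal⇒covered {M} M-max even {z} universal = decidable-stable (covered? M z) λ z∉ →
    let y , y∈ , y≢z = ∃-other-member (uncovered-unique M) even (∈-uncovered⁺ {M} z∉)
    in uncovered-nonadjacent {M = M} M-max (∈-uncovered⁻ {M} y∈) z∉ y≢z (universal y≢z)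

  module Normalisation (ι : Fin n → Fin n) (ι-involutive : ∀ x → ι (ι x) ≡ x)
                       {Q : Fin n → Set} (Q? : Decidable Q)
                       (ι-fixed⇒Q : ∀ {x} → ι x ≡ x → Q x) (R-ι : ∀ {x} → ι x ≢ x → R x (ι x)) where

    open Rerouting Fin._≟_ ι ι-involutive

    reroute-step : ∀ {N : Matching R} → IsMaximum N → ∀ {x} → ¬ Covered N x → ¬ Q x →
                   Σ (Matching R) λ N′ →
                     IsMaximum N′ × suc (misfits (Matching.edges N′)) ≡ misfits (Matching.edges N)
    reroute-step {N} N-max {x} x∉ ¬Qx with covered? N (ι x)
    ... | no ιx∉ = contradiction (R-ι ιx≢x) (uncovered-nonadjacent {M = N} N-max x∉ ιx∉ (ιx≢x ∘ sym))
      where ιx≢x = ¬Qx ∘ ι-fixed⇒Q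
    ... | yes ιx∈ = rerouted , rerouted-max , reroute-misfits x es ιx∈ x∉
      where
      es = Matching.edges N
      rerouted : Matching R
      rerouted = record
        { edges    = reroute x es ιx∈
        ; areEdges = reroute-edges x es ιx∈ (R-ι (¬Qx ∘ ι-fixed⇒Q)) (Matching.areEdges N)
        ; disjoint = reroute-unique x es ιx∈ x∉ (Matching.disjoint N)
        }
      rerouted-max : IsMaximum rerouted
      rerouted-max M′ = subst (size M′ ≤_) (sym (reroute-length x es ιx∈)) (N-max M′)

    normalise : (M : Matching R) → IsMaximum M →
                Σ (Matching R) λ N → IsMaximum N × (∀ x → ¬ Covered N x → Q x)
    normalise M M-max = go _ M refl M-max
      where
      go : ∀ k (N : Matching R) → misfits (Matching.edges N) ≡ k → IsMaximum N →
           Σ (Matching R) λ N → IsMaximum N × (∀ x → ¬ Covered N x → Q x)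
      go zero N misfits≡0 N-max = N , N-max , λ x x∉ → decidable-stable (Q? x) λ ¬Qx →
        1+n≢0 (trans (proj₂ (proj₂ (reroute-step {N} N-max x∉ ¬Qx))) misfits≡0)
      go (suc k) N misfits≡1+k N-max with Fin.any? (λ x → ¬? (covered? N x) ×-dec ¬? (Q? x))
      ... | no none = N , N-max , λ x x∉ → decidable-stable (Q? x) (λ ¬Qx → none (x , x∉ , ¬Qx))
      ... | yes (x , x∉ , ¬Qx) with N′ , N′-max , fewer ← reroute-step {N} N-max x∉ ¬Qx =
        go k N′ (suc-injective (trans fewer misfits≡1+k)) N′-max

module FromInvolution {A : Set} {R : A → A → Set}
  (σ : A → A) (σ-involutive : ∀ x → σ (σ x) ≡ x) (σ-fixedPointFree : ∀ x → σ x ≢ x)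
  (R-σ : ∀ x → R x (σ x))
  (code : A → ℕ) (code-injective : ∀ {x y} → code x ≡ code y → x ≡ y)
  (vertices : List A) (vertices-complete : ∀ x → x ∈ vertices) (vertices-unique : Unique vertices) where

  Leading : A → Set
  Leading x = code x < code (σ x)

  orbit : A → A × A
  orbit x = x , σ x

  leading? : Decidable Leading
  leading? x = code x <? code (σ x)

  leaders : List A
  leaders = filter leading? vertices

  private
    σ-injective : ∀ {x y} → σ x ≡ σ y → x ≡ y
    σ-injective {x} {y} σx≡σy = trans (sym (σ-involutive x)) (trans (cong σ σx≡σy) (σ-involutive y))

    leaders-apart : ∀ {x y} → Leading x → Leading y → x ≢ σ y
    leaders-apart {x} {y} x-leads y-leads refl =
      <-asym y-leads (subst (code (σ y) <_) (cong code (σ-involutive y)) x-leads)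

  ∈-endpoints-orbits : ∀ ys {z} → z ∈ endpoints (map orbit ys) → ∃ λ y → y ∈ ys × (z ≡ y ⊎ z ≡ σ y)
  ∈-endpoints-orbits (y ∷ ys) (here z≡y)         = y , here refl , inj₁ z≡y
  ∈-endpoints-orbits (y ∷ ys) (there (here z≡σy)) = y , here refl , inj₂ z≡σy
  ∈-endpoints-orbits (y ∷ ys) (there (there z∈)) with y′ , y′∈ , z≡ ← ∈-endpoints-orbits ys z∈ =
    y′ , there y′∈ , z≡

  orbits-cover : ∀ {ys y} → y ∈ ys → y ∈ endpoints (map orbit ys) × σ y ∈ endpoints (map orbit ys)
  orbits-cover (here refl) = here refl , there (here refl)
  orbits-cover (there y∈)  = Product.map (there ∘ there) (there ∘ there) (orbits-cover y∈)

  orbits-unique : ∀ ys → Unique ys → All Leading ys → Unique (endpoints (map orbit ys))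
  orbits-unique []       _               _                   = []
  orbits-unique (y ∷ ys) (y∉ys ∷ unique) (y-leads ∷ ys-lead) =
    ¬Any⇒All¬ _ y-fresh ∷ ¬Any⇒All¬ _ σy-fresh ∷ orbits-unique ys unique ys-lead
    where
    y-fresh : y ∉ σ y ∷ endpoints (map orbit ys)
    y-fresh (here y≡σy) = σ-fixedPointFree y (sym y≡σy)
    y-fresh (there y∈) with ∈-endpoints-orbits ys y∈
    ... | y′ , y′∈ , inj₁ y≡y′  = All¬⇒¬Any y∉ys (subst (_∈ ys) (sym y≡y′) y′∈)
    ... | y′ , y′∈ , inj₂ y≡σy′ = leaders-apart y-leads (All.lookup ys-lead y′∈) y≡σy′
    σy-fresh : σ y ∉ endpoints (map orbit ys)
    σy-fresh σy∈ with ∈-endpoints-orbits ys σy∈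
    ... | y′ , y′∈ , inj₁ σy≡y′  = leaders-apart (All.lookup ys-lead y′∈) y-leads (sym σy≡y′)
    ... | y′ , y′∈ , inj₂ σy≡σy′ = All¬⇒¬Any y∉ys (subst (_∈ ys) (sym (σ-injective σy≡σy′)) y′∈)

  perfectMatching : Σ (Matching R) IsPerfect
  perfectMatching = matching , covers
    where
    leaders-lead : All Leading leaders
    leaders-lead = All.tabulate λ x∈ → proj₂ (∈-filter⁻ leading? {xs = vertices} x∈)
    matching : Matching R
    matching = record
      { edges    = map orbit leaders
      ; areEdges = map⁺ (All.tabulate λ {x} _ → R-σ x)
      ; disjoint = orbits-unique leaders (filter⁺ leading? vertices-unique) leaders-lead
      }
    covers : IsPerfect matching
    covers v with leading? v
    ... | yes v-leads  = proj₁ (orbits-cover (∈-filter⁺ leading? (vertices-complete v) v-leads))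
    ... | no  v-trails = subst (_∈ endpoints (map orbit leaders)) (σ-involutive v)
                           (proj₂ (orbits-cover (∈-filter⁺ leading? (vertices-complete (σ v)) σv-leads)))
      where
      σv-leads : Leading (σ v)
      σv-leads = subst (code (σ v) <_) (cong code (sym (σ-involutive v)))
                   (≤∧≢⇒< (≮⇒≥ v-trails) (σ-fixedPointFree v ∘ code-injective))

module ProductPairing (G : FinGroup) (p : ℕ) .{{_ : NonZero p}}
  (p-prime : Prime p) (p-odd : ¬ 2 ∣ p) (μ : Matching (PG G))
  (μ-regular : ∀ g → ¬ Covered μ g → Powers.PRegular G p g)
  (ε-covered : Covered μ (FinGroup.ε G))
  (t-even : 2 ∣ length (FiniteGraph.uncovered μ))
  (t<p : length (FiniteGraph.uncovered μ) < p) where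

  open FinGroup G
  open Powers G
  open GroupProperties group using (ε⁻¹≈ε; ⁻¹-involutive)
  open Residues p
  open ProductPowers G p
  open FiniteGraph {R = PG G}

  U : List (Fin order)
  U = uncovered μ

  t : ℕ
  t = length U

  open import Data.List.Membership.DecPropositional (Fin._≟_ {order}) using (_∈?_)

  private
    suc-index<p : ∀ {g} (g∈U : g ∈ U) → suc (toℕ (index g∈U)) < p
    suc-index<p g∈U = ≤-trans (s≤s (Fin.toℕ<n (index g∈U))) t<p

  label : Fin order → Fin p
  label g with g ∈? U
  ... | yes g∈U = fromℕ< (suc-index<p g∈U)
  ... | no  _   = 0ₚ

  toℕ-label : ∀ {g} (g∈U : g ∈ U) → toℕ (label g) ≡ suc (toℕ (index g∈U))
  toℕ-label {g} g∈U rewrite dec-yes-irr (g ∈? U) (unique⇒irrelevant (uncovered-unique μ)) g∈U =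
    Fin.toℕ-fromℕ< (suc-index<p g∈U)

  private
    pred<t : ∀ {a} → a ≢ 0ₚ → toℕ a ≤ t → pred (toℕ a) < t
    pred<t a≢0 a≤t = subst (_≤ t) (sym (suc-pred _ {{≢-nonZero (≢0ₚ⇒toℕ≢0 a≢0)}})) a≤t

  vertexAt : ∀ a → .(a ≢ 0ₚ) → .(toℕ a ≤ t) → Fin order
  vertexAt a a≢0 a≤t = lookup U (fromℕ< (pred<t a≢0 a≤t))

  label-≢0ₚ : ∀ {g} → g ∈ U → label g ≢ 0ₚ
  label-≢0ₚ g∈U ℓ≡0 = 1+n≢0 (trans (sym (toℕ-label g∈U)) (trans (cong toℕ ℓ≡0) toℕ-0ₚ))

  label-≤t : ∀ {g} → g ∈ U → toℕ (label g) ≤ t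
  label-≤t g∈U = subst (_≤ t) (sym (toℕ-label g∈U)) (Fin.toℕ<n (index g∈U))

  vertexAt-label : ∀ {g} (g∈U : g ∈ U) → vertexAt (label g) (label-≢0ₚ g∈U) (label-≤t g∈U) ≡ g
  vertexAt-label {g} g∈U = begin
    lookup U (fromℕ< _)      ≡⟨ cong (lookup U) (Fin.fromℕ<-cong _ _ (cong pred (toℕ-label g∈U)) _ i<t) ⟩
    lookup U (fromℕ< i<t)    ≡⟨ cong (lookup U) (Fin.fromℕ<-toℕ (index g∈U) i<t) ⟩
    lookup U (index g∈U)     ≡⟨ lookup-index g∈U ⟨
    g                        ∎
    where
    open ≡-Reasoning
    i<t = Fin.toℕ<n (index g∈U)

  label-vertexAt : ∀ {a} (a≢0 : a ≢ 0ₚ) (a≤t : toℕ a ≤ t) → label (vertexAt a a≢0 a≤t) ≡ a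
  label-vertexAt {a} a≢0 a≤t = Fin.toℕ-injective (begin
    toℕ (label (lookup U i))          ≡⟨ toℕ-label (∈-lookup i) ⟩
    suc (toℕ (index (∈-lookup i)))    ≡⟨ cong (suc ∘ toℕ) (index-∈-lookup U i) ⟩
    suc (toℕ i)                       ≡⟨ cong suc (Fin.toℕ-fromℕ< (pred<t a≢0 a≤t)) ⟩
    suc (pred (toℕ a))                ≡⟨ suc-pred _ {{≢-nonZero (≢0ₚ⇒toℕ≢0 a≢0)}} ⟩
    toℕ a                             ∎)
    where
    open ≡-Reasoning
    i = fromℕ< (pred<t a≢0 a≤t)

  open Mates (Fin._≟_ {order})
  open Mirror t

  partner : Fin order → Fin order
  partner = mate (Matching.edges μ)

  σ : Fin order × Fin p → Fin order × Fin p
  σ (g , a) with a Fin.≟ 0ₚ | covered? μ g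
  ... | yes _   | yes _ = partner g , 0ₚ
  ... | yes _   | no  _ = g , label g
  ... | no  a≢0 | yes _ with g Fin.≟ ε
  ...   | yes _ with toℕ a ≤? t
  ...     | yes a≤t = vertexAt a a≢0 a≤t , - a
  ...     | no  _   = ε , mirror a
  σ (g , a) | no _ | yes _ | no _ with PRegular? p g
  ...     | yes _ = g , - a
  ...     | no  _ = g ⁻¹ , - a
  σ (g , a) | no _ | no _ with a Fin.≟ label g
  ... | yes _ = g , 0ₚ
  ... | no  _ with a Fin.≟ - label g
  ...   | yes _ = ε , label g
  ...   | no  _ = g , - a

  σ-covered₀ : ∀ {g} → Covered μ g → σ (g , 0ₚ) ≡ (partner g , 0ₚ)
  σ-covered₀ {g} g∈ rewrite proj₂ (dec-yes (0ₚ Fin.≟ 0ₚ) refl) | proj₂ (dec-yes (covered? μ g) g∈) = refl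

  σ-uncovered₀ : ∀ {g} → ¬ Covered μ g → σ (g , 0ₚ) ≡ (g , label g)
  σ-uncovered₀ {g} g∉ rewrite proj₂ (dec-yes (0ₚ Fin.≟ 0ₚ) refl) | dec-no (covered? μ g) g∉ = refl

  σ-ε-labelled : ∀ {a} (a≢0 : a ≢ 0ₚ) (a≤t : toℕ a ≤ t) → σ (ε , a) ≡ (vertexAt a a≢0 a≤t , - a)
  σ-ε-labelled {a} a≢0 a≤t
    rewrite dec-no (a Fin.≟ 0ₚ) a≢0 | proj₂ (dec-yes (covered? μ ε) ε-covered)
          | proj₂ (dec-yes (ε Fin.≟ ε) refl) | proj₂ (dec-yes (toℕ a ≤? t) a≤t) = refl

  σ-ε-mirrored : ∀ {a} → a ≢ 0ₚ → ¬ toℕ a ≤ t → σ (ε , a) ≡ (ε , mirror a)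
  σ-ε-mirrored {a} a≢0 a≰t
    rewrite dec-no (a Fin.≟ 0ₚ) a≢0 | proj₂ (dec-yes (covered? μ ε) ε-covered)
          | proj₂ (dec-yes (ε Fin.≟ ε) refl) | dec-no (toℕ a ≤? t) a≰t = refl

  σ-regular : ∀ {g a} → a ≢ 0ₚ → Covered μ g → g ≢ ε → PRegular p g → σ (g , a) ≡ (g , - a)
  σ-regular {g} {a} a≢0 g∈ g≢ε g-regular
    rewrite dec-no (a Fin.≟ 0ₚ) a≢0 | proj₂ (dec-yes (covered? μ g) g∈)
          | dec-no (g Fin.≟ ε) g≢ε | proj₂ (dec-yes (PRegular? p g) g-regular) = refl

  σ-irregular : ∀ {g a} → a ≢ 0ₚ → Covered μ g → g ≢ ε → ¬ PRegular p g → σ (g , a) ≡ (g ⁻¹ , - a)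
  σ-irregular {g} {a} a≢0 g∈ g≢ε g-irregular
    rewrite dec-no (a Fin.≟ 0ₚ) a≢0 | proj₂ (dec-yes (covered? μ g) g∈)
          | dec-no (g Fin.≟ ε) g≢ε | dec-no (PRegular? p g) g-irregular = refl

  σ-uncovered-label : ∀ {g} → ¬ Covered μ g → σ (g , label g) ≡ (g , 0ₚ)
  σ-uncovered-label {g} g∉
    rewrite dec-no (label g Fin.≟ 0ₚ) (label-≢0ₚ (∈-uncovered⁺ {μ} g∉)) | dec-no (covered? μ g) g∉
          | proj₂ (dec-yes (label g Fin.≟ label g) refl) = refl

  σ-uncovered-−label : ∀ {g} → ¬ Covered μ g → σ (g , - label g) ≡ (ε , label g)
  σ-uncovered-−label {g} g∉
    rewrite dec-no (- label g Fin.≟ 0ₚ) (-‿≢0ₚ (label-≢0ₚ (∈-uncovered⁺ {μ} g∉)))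
          | dec-no (covered? μ g) g∉
          | dec-no (- label g Fin.≟ label g) (-‿≢self p-odd (label-≢0ₚ (∈-uncovered⁺ {μ} g∉)))
          | proj₂ (dec-yes (- label g Fin.≟ - label g) refl) = refl

  σ-uncovered : ∀ {g a} → a ≢ 0ₚ → ¬ Covered μ g → a ≢ label g → a ≢ - label g → σ (g , a) ≡ (g , - a)
  σ-uncovered {g} {a} a≢0 g∉ a≢ℓ a≢-ℓ
    rewrite dec-no (a Fin.≟ 0ₚ) a≢0 | dec-no (covered? μ g) g∉
          | dec-no (a Fin.≟ label g) a≢ℓ | dec-no (a Fin.≟ - label g) a≢-ℓ = refl

  Paired : (x y : Fin order × Fin p) → Set
  Paired x y = σ x ≡ y × σ y ≡ x × PGxC G p x y

  Paired-sym : ∀ {x y} → Paired x y → Paired y x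
  Paired-sym (σx≡y , σy≡x , x~y) = σy≡x , σx≡y , PowerAdj-sym x~y

  private
    ≢₁ : ∀ {g h : Fin order} {a b : Fin p} → g ≢ h → (g , a) ≢ (h , b)
    ≢₁ g≢h = g≢h ∘ cong proj₁

    ≢₂ : ∀ {g h : Fin order} {a b : Fin p} → a ≢ b → (g , a) ≢ (h , b)
    ≢₂ a≢b = a≢b ∘ cong proj₂

    ε-regular : PRegular p ε
    ε-regular = ⁻¹-fixed⇒PRegular p-odd ε⁻¹≈ε

    irregular⇒covered : ∀ {g} → ¬ PRegular p g → Covered μ g
    irregular⇒covered {g} g-irregular = decidable-stable (covered? μ g) (g-irregular ∘ μ-regular g)

    irregular⇒≢ε : ∀ {g} → ¬ PRegular p g → g ≢ ε
    irregular⇒≢ε g-irregular refl = g-irregular ε-regular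

    ≢0ₚ-above-t : ∀ {a} → t < toℕ a → a ≢ 0ₚ
    ≢0ₚ-above-t t<a a≡0 = <⇒≢ (≤-<-trans z≤n t<a) (sym (trans (cong toℕ a≡0) toℕ-0ₚ))

  partner-paired : ∀ {g} → Covered μ g → Paired (g , 0ₚ) (partner g , 0ₚ)
  partner-paired {g} g∈ =
    σ-covered₀ g∈ ,
    trans (σ-covered₀ (mate-∈ es g∈)) (cong (_, 0ₚ) (mate-involutive es (Matching.disjoint μ) g)) ,
    ≢₁ g≢h , Sum.map layer₀∈⟨⟩ layer₀∈⟨⟩ h∈⟨g⟩⊎g∈⟨h⟩
    where
    es = Matching.edges μ
    adjacent : PG G g (partner g)
    adjacent with mate-edge es g∈
    ... | inj₁ e = All.lookup (Matching.areEdges μ) e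
    ... | inj₂ e = PowerAdj-sym (All.lookup (Matching.areEdges μ) e)
    g≢h = proj₁ adjacent
    h∈⟨g⟩⊎g∈⟨h⟩ = proj₂ adjacent

  label-paired : ∀ {g} → ¬ Covered μ g → Paired (g , 0ₚ) (g , label g)
  label-paired {g} g∉ =
    σ-uncovered₀ g∉ , σ-uncovered-label g∉ ,
    ≢₂ (label-≢0ₚ (∈-uncovered⁺ {μ} g∉) ∘ sym) ,
    inj₂ (regular⇒zero∈⟨⟩ (μ-regular g g∉) (label g))

  ε-paired : ∀ {g} → ¬ Covered μ g → Paired (ε , label g) (g , - label g)
  ε-paired {g} g∉ =
    trans (σ-ε-labelled (label-≢0ₚ g∈U) (label-≤t g∈U)) (cong (_, - label g) (vertexAt-label g∈U)) ,
    σ-uncovered-−label g∉ ,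
    ≢₁ (λ ε≡g → g∉ (subst (Covered μ) ε≡g ε-covered)) ,
    inj₂ (regular⇒ε∈⟨⟩ (μ-regular g g∉) (label g))
    where g∈U = ∈-uncovered⁺ {μ} g∉

  mirror-paired : ∀ {a} → t < toℕ a → Paired (ε , a) (ε , mirror a)
  mirror-paired {a} t<a =
    σ-ε-mirrored (≢0ₚ-above-t t<a) (<⇒≱ t<a) ,
    trans (σ-ε-mirrored (≢0ₚ-above-t (t<mirror t<a)) (<⇒≱ (t<mirror t<a)))
          (cong (ε ,_) (mirror-involutive t<a)) ,
    ≢₂ (mirror-≢ t<a p+t-odd ∘ sym) , inj₁ (ε-column∈⟨⟩ p-prime (≢0ₚ-above-t t<a) (mirror a))
    where
    p+t-odd : ¬ 2 ∣ p + t
    p+t-odd 2∣p+t = p-odd (∣m+n∣m⇒∣n (subst (2 ∣_) (+-comm p t) 2∣p+t) t-even)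

  inverse-paired : ∀ {g a} → a ≢ 0ₚ → ¬ PRegular p g → Paired (g , a) (g ⁻¹ , - a)
  inverse-paired {g} {a} a≢0 g-irregular =
    σ-irregular a≢0 (irregular⇒covered g-irregular) (irregular⇒≢ε g-irregular) g-irregular ,
    trans (σ-irregular (-‿≢0ₚ a≢0) (irregular⇒covered g⁻¹-irregular)
                       (irregular⇒≢ε g⁻¹-irregular) g⁻¹-irregular)
          (cong₂ _,_ (⁻¹-involutive g) (-‿involutive a)) ,
    ≢₁ (g-irregular ∘ ⁻¹-fixed⇒PRegular p-odd ∘ sym) , inj₁ (inverse∈⟨⟩ g a)
    where
    g⁻¹-irregular : ¬ PRegular p (g ⁻¹)
    g⁻¹-irregular = g-irregular ∘ PRegular-⁻¹

  private
    negation-paired : ∀ {g a} → PRegular p g → a ≢ 0ₚ →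
                      σ (g , a) ≡ (g , - a) → σ (g , - a) ≡ (g , - (- a)) → Paired (g , a) (g , - a)
    negation-paired {g} {a} g-regular a≢0 σ₁ σ₂ =
      σ₁ , trans σ₂ (cong (g ,_) (-‿involutive a)) ,
      ≢₂ (-‿≢self p-odd a≢0 ∘ sym) , inj₁ (regular⇒negation∈⟨⟩ g-regular a)

  regular-paired : ∀ {g a} → a ≢ 0ₚ → Covered μ g → g ≢ ε → PRegular p g → Paired (g , a) (g , - a)
  regular-paired a≢0 g∈ g≢ε g-regular = negation-paired g-regular a≢0
    (σ-regular a≢0 g∈ g≢ε g-regular) (σ-regular (-‿≢0ₚ a≢0) g∈ g≢ε g-regular)

  uncovered-paired : ∀ {g a} → a ≢ 0ₚ → ¬ Covered μ g → a ≢ label g → a ≢ - label g →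
                     Paired (g , a) (g , - a)
  uncovered-paired {g} {a} a≢0 g∉ a≢ℓ a≢-ℓ = negation-paired (μ-regular g g∉) a≢0
    (σ-uncovered a≢0 g∉ a≢ℓ a≢-ℓ)
    (σ-uncovered (-‿≢0ₚ a≢0) g∉ (λ -a≡ℓ → a≢-ℓ (trans (sym (-‿involutive a)) (cong -_ -a≡ℓ)))
                 (a≢ℓ ∘ -‿injective))

  paired : ∀ g a → ∃ (Paired (g , a))
  paired g a = classify g a (a Fin.≟ 0ₚ) (covered? μ g)
    where
    -- The first two decisions are arguments rather than with-abstractions, which would also
    -- abstract their occurrences inside σ (g , a) and detach it from the σ-equations above.
    classify : ∀ g a → Dec (a ≡ 0ₚ) → Dec (Covered μ g) → ∃ (Paired (g , a))
    classify g a (yes refl) (yes g∈) = _ , partner-paired g∈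
    classify g a (yes refl) (no  g∉) = _ , label-paired g∉
    classify g a (no  a≢0)  (yes g∈) with g Fin.≟ ε
    ... | yes refl with toℕ a ≤? t
    ...   | yes a≤t = _ , subst (λ b → Paired (ε , b) (vertexAt a a≢0 a≤t , - b)) (label-vertexAt a≢0 a≤t)
                            (ε-paired (∈-uncovered⁻ {μ} (∈-lookup _)))
    ...   | no  a≰t = _ , mirror-paired (≰⇒> a≰t)
    classify g a (no a≢0) (yes g∈) | no g≢ε with PRegular? p g
    ...   | yes g-regular   = _ , regular-paired a≢0 g∈ g≢ε g-regular
    ...   | no  g-irregular = _ , inverse-paired a≢0 g-irregular
    classify g a (no a≢0) (no g∉) with a Fin.≟ label g | a Fin.≟ - label g
    ... | yes refl | _        = _ , Paired-sym (label-paired g∉)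
    ... | no  _    | yes refl = _ , Paired-sym (ε-paired g∉)
    ... | no  a≢ℓ  | no  a≢-ℓ = _ , uncovered-paired a≢0 g∉ a≢ℓ a≢-ℓ

  perfectMatching : Σ (Matching (PGxC G p)) IsPerfect
  perfectMatching = FromInvolution.perfectMatching σ σ-involutive σ-fixedPointFree σ-adjacent
    code code-injective
    (cartesianProduct (allFin order) (allFin p))
    (λ (g , a) → ∈-cartesianProduct⁺ (∈-allFin g) (∈-allFin a))
    (cartesianProduct⁺ (allFin⁺ order) (allFin⁺ p))
    where
    σ-involutive : ∀ x → σ (σ x) ≡ x
    σ-involutive (g , a) with _ , σx≡y , σy≡x , _ ← paired g a = trans (cong σ σx≡y) σy≡x
    σ-fixedPointFree : ∀ x → σ x ≢ x
    σ-fixedPointFree (g , a) σx≡x with _ , σx≡y , _ , x≢y , _ ← paired g a = x≢y (trans (sym σx≡x) σx≡y)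
    σ-adjacent : ∀ x → PGxC G p x (σ x)
    σ-adjacent (g , a) with _ , σx≡y , _ , adjacent ← paired g a =
      subst (PGxC G p (g , a)) (sym σx≡y) adjacent
    code : Fin order × Fin p → ℕ
    code (g , a) = toℕ (combine g a)
    code-injective : ∀ {x y} → code x ≡ code y → x ≡ y
    code-injective {g , a} {h , b} same =
      trans (sym (Fin.remQuot-combine g a))
            (trans (cong (remQuot p) (Fin.toℕ-injective same)) (Fin.remQuot-combine h b))

mainTheorem11 : (G : FinGroup) → 2 ∣ FinGroup.order G →
    (M : Matching (PG G)) → IsMaximum M →
    (p : ℕ) → (pr : Prime p) → ¬ (2 ∣ p) →
    FinGroup.order G ∸ 2 * size M < p →
    Σ (Matching (PGxC G p {{prime⇒nonZero pr}})) IsPerfect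
mainTheorem11 G order-even M M-max p p-prime p-odd deficiency<p =
  ProductPairing.perfectMatching G p p-prime p-odd μ μ-regular ε-covered t-even t<p
  where
  instance _ = prime⇒nonZero p-prime
  open FinGroup G
  open Powers G
  open GroupProperties group using (⁻¹-involutive)
  open FiniteGraph {R = PG G}
  open Normalisation _⁻¹ ⁻¹-involutive (PRegular? p) (⁻¹-fixed⇒PRegular p-odd) ⁻¹-adjacent

  normalised = normalise M M-max
  μ = proj₁ normalised
  μ-max = proj₁ (proj₂ normalised)
  μ-regular = proj₂ (proj₂ normalised)

  t-even : 2 ∣ length (uncovered μ)
  t-even = uncovered-even μ order-even

  t<p : length (uncovered μ) < p
  t<p = subst (_< p)
    (trans (cong (λ s → order ∸ 2 * s) (≤-antisym (μ-max M) (M-max μ))) (sym (length-uncovered μ))) deficiency<p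

  ε-covered : Covered μ ε
  ε-covered = universal⇒covered {M = μ} μ-max t-even λ y≢ε → y≢ε , inj₁ (0 , refl)
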